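{- Let $1\leq X, Y \leq 2n$ and $X\neq Y$. Then \[ f_n\!\left[\begin{smallmatrix}X\\ Y\end{smallmatrix}\right] = \sum_{x,y} f_{n-1}\!\left[\begin{smallmatrix}x\\ y\end{smallmatrix}\right], \] where the sum ranges over all ordered pairs $(x,y)\in[2n-2]\times[2n-2]$ such that the reduction of the $2\times 2$ array $\left[\begin{smallmatrix}\Omega^{ -1}(x; X, Y) & X \\ \Omega^{ -1}(y; X, Y) & Y\end{smallmatrix}\right]$ is a piece in $\mathcal{P}$.
   Context: A piece is a unit square with four numbers (labels) written on its corners; a puzzle is a connected arrangement of pieces in the $\mathbb{Z}\times\mathbb{Z}$-plane (translations only, no rotations or reflections) such that joining corners carry the same labels. A standard puzzle of a given shape is one whose multiset of all labels is exactly $\{1,2,\ldots,m\}$, $m$ being the number of vertices of the shape. The reduction $\Omega$ of a piece replaces its four (distinct) labels by $1,2,3,4$ respecting their relative order, giving a standard piece. Fix a set $\mathcal{P}$ of standard pieces (the support); a puzzle has support $\mathcal{P}$ if the reduction of each of its pieces lies in $\mathcal{P}$. Consider standard puzzles of shape $2\times n$ with support $\mathcal{P}$, written as two-row matrices (top row over bottom row, each column being a pair of vertically aligned vertices). For $1\le X\ne Y\le 2n$, let $f_n\!\left[\begin{smallmatrix}X\\ Y\end{smallmatrix}\right]$ denote the number of such puzzles whose rightmost column has top label $X$ and bottom label $Y$. The inverse reduction of $x$ by $\{X,Y\}$ is $\Omega^{ -1}(x;X,Y)=x$ if $x\le a-1$, $=x+1$ if $a\le x\le b-2$, $=x+2$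 if $b-1\le x$, where $a=\min(X,Y)$ and $b=\max(X,Y)$. -}

module Defs where

open import Data.Nat using (ℕ; zero; suc; _+_; _*_; _∸_; _<ᵇ_; _≡ᵇ_)
open import Data.Bool using (Bool; true; false; _∧_; if_then_else_)
open import Data.List using (List; []; _∷_; map; concatMap; upTo; length)
open import Data.Vec using (Vec; []; _∷_)
open import Data.Product using (_×_; _,_)

range : ℕ → List ℕ
range k = map suc (upTo k)

countB : {A : Set} → (A → Bool) → List A → ℕ
countB p []       = 0
countB p (x ∷ xs) = if p x then suc (countB p xs) else countB p xs

allB : {A : Set} → (A → Bool) → List A → Bool
allB p []       = true
allB p (x ∷ xs) = p x ∧ allB p xs

isStandardLabels : ℕ → List ℕ → Bool
isStandardLabels m ls =
  (length ls ≡ᵇ m) ∧ allB (λ k → countB (λ l → l ≡ᵇ k) ls ≡ᵇ 1) (range m)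

record Piece : Set where
  constructor piece
  field
    tl tr bl br : ℕ

open Piece public

pieceLabels : Piece → List ℕ
pieceLabels (piece a b c d) = a ∷ b ∷ c ∷ d ∷ []

isStandardPiece : Piece → Bool
isStandardPiece p = isStandardLabels 4 (pieceLabels p)

-- reduction Ω: replace each label by its rank (1..4) among the four labels
lt : ℕ → ℕ → ℕ
lt m n = if m <ᵇ n then 1 else 0

rank : ℕ → ℕ → ℕ → ℕ → ℕ
rank x p q r = suc (lt p x + lt q x + lt r x)

Ω : Piece → Piece
Ω (piece a b c d) =
  piece (rank a b c d) (rank b a c d) (rank c a b d) (rank d a b c)

-- Puzzles of shape 2 × n, as two-row arrays given column by column:
-- each column is (top label , bottom label).

Array : ℕ → Set
Array n = Vec (ℕ × ℕ) n

arrayLabels : {n : ℕ} → Array n → List ℕ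
arrayLabels []            = []
arrayLabels ((t , b) ∷ v) = t ∷ b ∷ arrayLabels v

isStandardArray : {n : ℕ} → Array n → Bool
isStandardArray {n} v = isStandardLabels (2 * n) (arrayLabels v)

hasSupport : (Piece → Bool) → {n : ℕ} → Array n → Bool
hasSupport P []                              = true
hasSupport P (_ ∷ [])                        = true
hasSupport P ((t₁ , b₁) ∷ (t₂ , b₂) ∷ v) =
  P (Ω (piece t₁ t₂ b₁ b₂)) ∧ hasSupport P ((t₂ , b₂) ∷ v)

lastColumnIs : ℕ → ℕ → {n : ℕ} → Array n → Bool
lastColumnIs X Y []            = false
lastColumnIs X Y ((t , b) ∷ []) = (t ≡ᵇ X) ∧ (b ≡ᵇ Y)
lastColumnIs X Y (_ ∷ c ∷ v)   = lastColumnIs X Y (c ∷ v)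

pairs : ℕ → List (ℕ × ℕ)
pairs k = concatMap (λ a → map (λ b → (a , b)) (range k)) (range k)

arrays : (n k : ℕ) → List (Array n)
arrays zero    k = [] ∷ []
arrays (suc n) k = concatMap (λ c → map (c ∷_) (arrays n k)) (pairs k)

f : (Piece → Bool) → (n X Y : ℕ) → ℕ
f P n X Y =
  countB (λ v → isStandardArray v ∧ hasSupport P v ∧ lastColumnIs X Y v)
         (arrays n (2 * n))

min' max' : ℕ → ℕ → ℕ
min' m n = if m <ᵇ n then m else n
max' m n = if m <ᵇ n then n else m

Ω⁻¹ : ℕ → ℕ → ℕ → ℕ
Ω⁻¹ x X Y =
  if x <ᵇ a then x
  else if x <ᵇ b ∸ 1 then suc x
  else suc (suc x)
  where
    a = min' X Y
    b = max' X Y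

sumOverPairs : (ℕ × ℕ → ℕ) → List (ℕ × ℕ) → ℕ
sumOverPairs g []       = 0
sumOverPairs g (p ∷ ps) = g p + sumOverPairs g ps

recursionRHS : (Piece → Bool) → (n X Y : ℕ) → ℕ
recursionRHS P n X Y =
  sumOverPairs
    (λ { (x , y) →
         if P (Ω (piece (Ω⁻¹ x X Y) X (Ω⁻¹ y X Y) Y))
         then f P (n ∸ 1) x y else 0 })
    (pairs (2 * n ∸ 2))

module Submission where

open import Defs
open import Algebra.Core using (Op₂)
open import Algebra.Structures using (IsCommutativeMonoid)
open import Data.Bool using (Bool; true; false; _∧_; if_then_else_)
open import Data.Bool.Properties using (∧-isCommutativeMonoid; ∧-zeroʳ; ∧-identityʳ; ∧-assoc)
open import Data.Empty using (⊥-elim)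
open import Data.List using (List; []; _∷_; _++_; map; upTo; foldr; concatMap; length)
open import Data.List.Properties using (map-∘; map-cong; map-++; map-applyUpTo; length-map)
open import Data.List.Relation.Binary.Permutation.Propositional
  using (_↭_; ↭-refl; ↭-reflexive; ↭-swap; ↭⇒↭ₛ; module PermutationReasoning)
open import Data.List.Relation.Binary.Permutation.Propositional.Properties
  using (map⁺; ↭-length; ++-comm; ++⁺ʳ)
open import Data.List.Relation.Binary.Permutation.Setoid.Properties using (foldr-commMonoid)
open import Data.List.Relation.Unary.All using (All; []; _∷_)
open import Data.List.Relation.Unary.Any using (Any; here; there)
open import Data.List.Relation.Unary.Any.Properties using (Any-⊎⁻)
open import Data.Nat using (ℕ; zero; suc; _+_; _*_; _∸_; _<ᵇ_; _≡ᵇ_; _≤_; _<_; z≤n; s≤s)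
open import Data.Nat.ListAction using (sum)
open import Data.Nat.ListAction.Properties using (sum-++)
open import Data.Nat.Properties
  using (_<?_; _≟_; <-cmp; n≮n; n≤1+n; ≤-refl; ≤-trans; <-trans; <-≤-trans; m≤n⇒m≤1+n;
         ≮⇒≥; ≤⇒≯; <⇒≢; <⇒≤; ≤∧≢⇒<; +-identityʳ; *-suc;
         +-0-isCommutativeMonoid; +-commutativeSemigroup)
open import Algebra.Properties.CommutativeSemigroup +-commutativeSemigroup using (interchange)
open import Data.Product as Product using (_×_; _,_; proj₁; proj₂)
open import Data.Sum as Sum using (_⊎_; inj₁; inj₂)
open import Data.Vec as Vec using ([]; _∷_; _∷ʳ_)
open import Function using (_∘_)
open import Relation.Binary.Core using (_Preserves_⟶_)
open import Relation.Binary.Definitions using (tri<; tri≈; tri>)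
open import Relation.Binary.PropositionalEquality
  using (_≡_; _≢_; ≢-sym; refl; sym; trans; cong; cong₂; subst; subst₂; setoid; module ≡-Reasoning)
open import Relation.Nullary using (¬_; yes; no)
open import Relation.Nullary.Decidable using (dec-true; dec-false)

-- Removing the last column (X, Y) from a standard 2×n puzzle leaves a 2×(n−1) array whose labels
-- are exactly [2n] ∖ {X, Y}.  Now Ω⁻¹(·; X, Y) is the increasing bijection [2n−2] → [2n] ∖ {X, Y},
-- and reduction only sees the relative order of labels, so relabelling along it preserves the
-- support.  Hence the puzzles counted by f_n[X; Y] correspond to the standard 2×(n−1) puzzles with
-- support P whose last column (x, y) satisfies Ω[Ω⁻¹(x) X; Ω⁻¹(y) Y] ∈ P, and grouping these by
-- (x, y) gives the right-hand side.  Both sides are computed as the same sum over 2×(n−1) arrays: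
-- on the left the sum over the last column collapses at (X, Y) and the arrays using X or Y drop
-- out (they are not standard); on the right the sum over (x, y) collapses at the last column.

<ᵇ-true : ∀ {m n} → m < n → (m <ᵇ n) ≡ true
<ᵇ-true {m} {n} = dec-true (m <? n)

<ᵇ-false : ∀ {m n} → ¬ m < n → (m <ᵇ n) ≡ false
<ᵇ-false {m} {n} = dec-false (m <? n)

≡ᵇ-true : ∀ {m n} → m ≡ n → (m ≡ᵇ n) ≡ true
≡ᵇ-true {m} {n} = dec-true (m ≟ n)

≡ᵇ-false : ∀ {m n} → m ≢ n → (m ≡ᵇ n) ≡ false
≡ᵇ-false {m} {n} = dec-false (m ≟ n)

≡ᵇ-∧-false : ∀ {t u X Y} → t ≢ X ⊎ u ≢ Y → (t ≡ᵇ X) ∧ (u ≡ᵇ Y) ≡ false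
≡ᵇ-∧-false (inj₁ t≢X) rewrite ≡ᵇ-false t≢X = refl
≡ᵇ-∧-false (inj₂ u≢Y) rewrite ≡ᵇ-false u≢Y = ∧-zeroʳ _

≡ᵇ-∧-refl : ∀ t u → (t ≡ᵇ t) ∧ (u ≡ᵇ u) ≡ true
≡ᵇ-∧-refl t u = cong₂ _∧_ (≡ᵇ-true {t} refl) (≡ᵇ-true {u} refl)

∧-zeroʳ² : ∀ p q → p ∧ (q ∧ false) ≡ false
∧-zeroʳ² p q = trans (cong (p ∧_) (∧-zeroʳ q)) (∧-zeroʳ p)

∧-rotate : ∀ p q r → p ∧ (q ∧ (r ∧ true)) ≡ q ∧ (r ∧ p)
∧-rotate true  q r = refl
∧-rotate false q r = sym (∧-zeroʳ² q r)

module _ {h : ℕ → ℕ} (h-mono : h Preserves _<_ ⟶ _<_) where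

  strictMono-injective : ∀ {i j} → h i ≡ h j → i ≡ j
  strictMono-injective {i} {j} hi≡hj with <-cmp i j
  ... | tri< i<j _ _ = ⊥-elim (<⇒≢ (h-mono i<j) hi≡hj)
  ... | tri≈ _ i≡j _ = i≡j
  ... | tri> _ _ j<i = ⊥-elim (<⇒≢ (h-mono j<i) (sym hi≡hj))

  strictMono-<ᵇ : ∀ i j → (h i <ᵇ h j) ≡ (i <ᵇ j)
  strictMono-<ᵇ i j with <-cmp i j
  ... | tri< i<j _ _  = trans (<ᵇ-true (h-mono i<j)) (sym (<ᵇ-true i<j))
  ... | tri≈ _ refl _ = trans (<ᵇ-false (n≮n (h i))) (sym (<ᵇ-false (n≮n i)))
  ... | tri> _ _ j<i  = trans (<ᵇ-false (≤⇒≯ (<⇒≤ (h-mono j<i)))) (sym (<ᵇ-false (≤⇒≯ (<⇒≤ j<i))))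

  strictMono-≡ᵇ : ∀ i j → (h i ≡ᵇ h j) ≡ (i ≡ᵇ j)
  strictMono-≡ᵇ i j with i ≟ j
  ... | yes refl = trans (≡ᵇ-true {h i} refl) (sym (≡ᵇ-true {i} refl))
  ... | no  i≢j  = trans (≡ᵇ-false (i≢j ∘ strictMono-injective)) (sym (≡ᵇ-false i≢j))

-- Punching holes into ℕ

punchIn : ℕ → ℕ → ℕ
punchIn c i = if i <ᵇ c then i else suc i

punchIn-< : ∀ {c i} → i < c → punchIn c i ≡ i
punchIn-< i<c rewrite <ᵇ-true i<c = refl

punchIn-≥ : ∀ {c i} → c ≤ i → punchIn c i ≡ suc i
punchIn-≥ c≤i rewrite <ᵇ-false (≤⇒≯ c≤i) = refl

punchIn-≤ : ∀ c i → punchIn c i ≤ suc i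
punchIn-≤ c i with i <ᵇ c
... | true  = n≤1+n i
... | false = ≤-refl

punchIn-≢ : ∀ c i → punchIn c i ≢ c
punchIn-≢ c i with i <? c
... | yes i<c = λ eq → <⇒≢ i<c (trans (sym (punchIn-< i<c)) eq)
... | no  i≮c = λ eq → n≮n i (subst (_≤ i) (trans (sym eq) (punchIn-≥ c≤i)) c≤i)
  where c≤i = ≮⇒≥ i≮c

punchIn-suc : ∀ c i → punchIn (suc c) (suc i) ≡ suc (punchIn c i)
punchIn-suc c i with i <ᵇ c
... | true  = refl
... | false = refl

punchIn-mono : ∀ c → punchIn c Preserves _<_ ⟶ _<_
punchIn-mono c {i} {j} i<j with j <? c
... | yes j<c = subst₂ _<_ (sym (punchIn-< (<-trans i<j j<c))) (sym (punchIn-< j<c)) i<j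
... | no  j≮c = subst (punchIn c i <_) (sym (punchIn-≥ (≮⇒≥ j≮c))) (s≤s (≤-trans (punchIn-≤ c i) i<j))

punchIn-pred : ∀ {a b} → a < b → punchIn a (b ∸ 1) ≡ b
punchIn-pred (s≤s a≤b′) = punchIn-≥ a≤b′

-- For a < b, punching b − 1 and then a moves the first hole up to b: this enumerates ℕ ∖ {a, b}.
punchIn₂ : ℕ → ℕ → ℕ → ℕ
punchIn₂ a b = punchIn a ∘ punchIn (b ∸ 1)

punchIn₂-mono : ∀ a b → punchIn₂ a b Preserves _<_ ⟶ _<_
punchIn₂-mono a b = punchIn-mono a ∘ punchIn-mono (b ∸ 1)

punchIn₂-≢ˡ : ∀ a b i → punchIn₂ a b i ≢ a
punchIn₂-≢ˡ a b i = punchIn-≢ a (punchIn (b ∸ 1) i)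

punchIn₂-≢ʳ : ∀ {a b} → a < b → ∀ i → punchIn₂ a b i ≢ b
punchIn₂-≢ʳ {a} {b} a<b i eq =
  punchIn-≢ (b ∸ 1) i (strictMono-injective (punchIn-mono a) (trans eq (sym (punchIn-pred a<b))))

-- The body of Ω⁻¹ x X Y, with a = min' X Y and b = max' X Y.
Ω⁻¹-body-punchIn₂ : ∀ x {a b} → a < b →
  (if x <ᵇ a then x else if x <ᵇ b ∸ 1 then suc x else suc (suc x)) ≡ punchIn₂ a b x
Ω⁻¹-body-punchIn₂ x {a} {suc b′} (s≤s a≤b′) with x <? a
... | yes x<a = begin
  (if x <ᵇ a then x else if x <ᵇ b′ then suc x else suc (suc x))
    ≡⟨ cong (if_then x else (if x <ᵇ b′ then suc x else suc (suc x))) (<ᵇ-true x<a) ⟩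
  x
    ≡⟨ punchIn-< x<a ⟨
  punchIn a x
    ≡⟨ cong (punchIn a) (punchIn-< (<-≤-trans x<a a≤b′)) ⟨
  punchIn₂ a (suc b′) x
    ∎
  where open ≡-Reasoning
... | no x≮a with x <? b′
...   | yes x<b′ = begin
  (if x <ᵇ a then x else if x <ᵇ b′ then suc x else suc (suc x))
    ≡⟨ cong₂ (λ c d → if c then x else if d then suc x else suc (suc x)) (<ᵇ-false x≮a) (<ᵇ-true x<b′) ⟩
  suc x
    ≡⟨ punchIn-≥ (≮⇒≥ x≮a) ⟨
  punchIn a x
    ≡⟨ cong (punchIn a) (punchIn-< x<b′) ⟨
  punchIn₂ a (suc b′) x
    ∎
  where open ≡-Reasoning
...   | no x≮b′ = begin
  (if x <ᵇ a then x else if x <ᵇ b′ then suc x else suc (suc x))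
    ≡⟨ cong₂ (λ c d → if c then x else if d then suc x else suc (suc x)) (<ᵇ-false x≮a) (<ᵇ-false x≮b′) ⟩
  suc (suc x)
    ≡⟨ punchIn-≥ (m≤n⇒m≤1+n (≮⇒≥ x≮a)) ⟨
  punchIn a (suc x)
    ≡⟨ cong (punchIn a) (punchIn-≥ (≮⇒≥ x≮b′)) ⟨
  punchIn₂ a (suc b′) x
    ∎
  where open ≡-Reasoning

Ω⁻¹-punchIn₂ : ∀ x X Y → min' X Y < max' X Y → Ω⁻¹ x X Y ≡ punchIn₂ (min' X Y) (max' X Y) x
Ω⁻¹-punchIn₂ x X Y = Ω⁻¹-body-punchIn₂ x

InRange : ℕ → ℕ → Set
InRange N i = 1 ≤ i × i ≤ N

min'<max' : ∀ {X Y} → X ≢ Y → min' X Y < max' X Y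
min'<max' {X} {Y} X≢Y with X <? Y
... | yes X<Y rewrite <ᵇ-true X<Y = X<Y
... | no  X≮Y rewrite <ᵇ-false X≮Y = ≤∧≢⇒< (≮⇒≥ X≮Y) (X≢Y ∘ sym)

min'-max'-InRange : ∀ {N X Y} → InRange N X → InRange N Y → InRange N (min' X Y) × InRange N (max' X Y)
min'-max'-InRange {X = X} {Y} X∈ Y∈ with X <ᵇ Y
... | true  = X∈ , Y∈
... | false = Y∈ , X∈

↭-min'-max' : ∀ X Y → X ∷ Y ∷ [] ↭ min' X Y ∷ max' X Y ∷ []
↭-min'-max' X Y with X <ᵇ Y
... | true  = ↭-refl
... | false = ↭-swap X Y ↭-refl

range-suc : ∀ N → range (suc N) ≡ 1 ∷ map suc (range N)
range-suc N = cong (λ L → 1 ∷ map suc L) (sym (map-applyUpTo (λ i → i) suc N))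

range-↭-punchIn : ∀ N c → 1 ≤ c → c ≤ suc N → range (suc N) ↭ c ∷ map (punchIn c) (range N)
range-↭-punchIn N 1 _ _ = ↭-reflexive (begin
  range (suc N)                      ≡⟨ range-suc N ⟩
  1 ∷ map suc (map suc (upTo N))     ≡⟨ cong (1 ∷_) (map-∘ (upTo N)) ⟨
  1 ∷ map (punchIn 1 ∘ suc) (upTo N) ≡⟨ cong (1 ∷_) (map-∘ (upTo N)) ⟩
  1 ∷ map (punchIn 1) (range N)      ∎)
  where open ≡-Reasoning
range-↭-punchIn zero (suc (suc c)) _ (s≤s ())
range-↭-punchIn (suc N) (suc (suc c)) _ (s≤s c<1+N) = begin
  range (suc (suc N))
    ≡⟨ range-suc (suc N) ⟩
  1 ∷ map suc (range (suc N))
    <⟨ map⁺ suc (range-↭-punchIn N (suc c) (s≤s z≤n) c<1+N) ⟩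
  1 ∷ suc (suc c) ∷ map suc (map (punchIn (suc c)) (range N))
    <<⟨ ↭-refl ⟩
  suc (suc c) ∷ 1 ∷ map suc (map (punchIn (suc c)) (range N))
    ≡⟨ cong (λ L → suc (suc c) ∷ 1 ∷ L) shift ⟩
  suc (suc c) ∷ map (punchIn (suc (suc c))) (1 ∷ map suc (range N))
    ≡⟨ cong (λ L → suc (suc c) ∷ map (punchIn (suc (suc c))) L) (range-suc N) ⟨
  suc (suc c) ∷ map (punchIn (suc (suc c))) (range (suc N))
    ∎
  where
  open PermutationReasoning
  shift : map suc (map (punchIn (suc c)) (range N)) ≡ map (punchIn (suc (suc c))) (map suc (range N))
  shift = trans (sym (map-∘ (range N)))
                (trans (map-cong (λ i → sym (punchIn-suc (suc c) i)) (range N)) (map-∘ (range N)))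

range-↭-punchIn₂ : ∀ k {a b} → 1 ≤ a → a < b → b ≤ suc (suc k) →
  range (suc (suc k)) ↭ a ∷ b ∷ map (punchIn₂ a b) (range k)
range-↭-punchIn₂ k {a} {suc b′} 1≤a a<b@(s≤s a≤b′) (s≤s b′≤1+k) = begin
  range (suc (suc k))
    ↭⟨ range-↭-punchIn (suc k) a 1≤a (m≤n⇒m≤1+n (≤-trans a≤b′ b′≤1+k)) ⟩
  a ∷ map (punchIn a) (range (suc k))
    <⟨ map⁺ (punchIn a) (range-↭-punchIn k b′ (≤-trans 1≤a a≤b′) b′≤1+k) ⟩
  a ∷ punchIn a b′ ∷ map (punchIn a) (map (punchIn b′) (range k))
    ≡⟨ cong₂ (λ x L → a ∷ x ∷ L) (punchIn-pred a<b) (sym (map-∘ (range k))) ⟩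
  a ∷ suc b′ ∷ map (punchIn₂ a (suc b′)) (range k)
    ∎
  where open PermutationReasoning

-- Finite sums

module _ {A : Set} {_∙_ : Op₂ A} {ε : A} (isCM : IsCommutativeMonoid _≡_ _∙_ ε) where

  foldr-map-↭ : {B : Set} (F : B → A) {xs ys : List B} → xs ↭ ys →
    foldr _∙_ ε (map F xs) ≡ foldr _∙_ ε (map F ys)
  foldr-map-↭ F xs↭ys = foldr-commMonoid (setoid A) isCM (↭⇒↭ₛ (map⁺ F xs↭ys))

  foldr-map-range-punchIn : ∀ N {c} → 1 ≤ c → c ≤ suc N → (F : ℕ → A) →
    foldr _∙_ ε (map F (range (suc N))) ≡ F c ∙ foldr _∙_ ε (map (F ∘ punchIn c) (range N))
  foldr-map-range-punchIn N 1≤c c≤1+N F =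
    trans (foldr-map-↭ F (range-↭-punchIn N _ 1≤c c≤1+N))
          (cong (λ L → F _ ∙ foldr _∙_ ε L) (sym (map-∘ (range N))))

  foldr-map-range-punchIn₂ : ∀ k {a b} → 1 ≤ a → a < b → b ≤ suc (suc k) → (F : ℕ → A) →
    foldr _∙_ ε (map F (range (suc (suc k)))) ≡ F a ∙ (F b ∙ foldr _∙_ ε (map (F ∘ punchIn₂ a b) (range k)))
  foldr-map-range-punchIn₂ k 1≤a a<b b≤2+k F =
    trans (foldr-map-↭ F (range-↭-punchIn₂ k 1≤a a<b b≤2+k))
          (cong (λ L → F _ ∙ (F _ ∙ foldr _∙_ ε L)) (sym (map-∘ (range k))))

sumOver : {A : Set} → List A → (A → ℕ) → ℕ
sumOver xs F = sum (map F xs)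

syntax sumOver xs (λ x → e) = ∑[ x ← xs ] e

sumOver-cong : {A : Set} {F G : A → ℕ} → (∀ x → F x ≡ G x) → ∀ xs → sumOver xs F ≡ sumOver xs G
sumOver-cong F≗G xs = cong sum (map-cong F≗G xs)

sumOver-zero : {A : Set} {F : A → ℕ} → (∀ x → F x ≡ 0) → ∀ xs → sumOver xs F ≡ 0
sumOver-zero F≗0 []       = refl
sumOver-zero F≗0 (x ∷ xs) = cong₂ _+_ (F≗0 x) (sumOver-zero F≗0 xs)

sumOver-map : {A B : Set} (F : B → ℕ) (g : A → B) → ∀ xs → sumOver (map g xs) F ≡ sumOver xs (F ∘ g)
sumOver-map F g xs = cong sum (sym (map-∘ xs))

sumOver-concatMap : {A B : Set} (F : B → ℕ) (g : A → List B) → ∀ xs →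
  sumOver (concatMap g xs) F ≡ ∑[ x ← xs ] sumOver (g x) F
sumOver-concatMap F g []       = refl
sumOver-concatMap F g (x ∷ xs) = begin
  sum (map F (g x ++ concatMap g xs))               ≡⟨ cong sum (map-++ F (g x) (concatMap g xs)) ⟩
  sum (map F (g x) ++ map F (concatMap g xs))       ≡⟨ sum-++ (map F (g x)) _ ⟩
  sumOver (g x) F + sumOver (concatMap g xs) F      ≡⟨ cong (sumOver (g x) F +_) (sumOver-concatMap F g xs) ⟩
  sumOver (g x) F + (∑[ y ← xs ] sumOver (g y) F)   ∎
  where open ≡-Reasoning

sumOver-+ : {A : Set} (F G : A → ℕ) → ∀ xs → (∑[ x ← xs ] (F x + G x)) ≡ sumOver xs F + sumOver xs G
sumOver-+ F G []       = refl
sumOver-+ F G (x ∷ xs) =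
  trans (cong (F x + G x +_) (sumOver-+ F G xs)) (interchange (F x) (G x) (sumOver xs F) (sumOver xs G))

sumOver-swap : {A B : Set} (F : A → B → ℕ) → ∀ xs ys →
  (∑[ x ← xs ] ∑[ y ← ys ] F x y) ≡ (∑[ y ← ys ] ∑[ x ← xs ] F x y)
sumOver-swap F []       ys = sym (sumOver-zero (λ _ → refl) ys)
sumOver-swap F (x ∷ xs) ys = begin
  sumOver ys (F x) + (∑[ x′ ← xs ] sumOver ys (F x′))    ≡⟨ cong (sumOver ys (F x) +_) (sumOver-swap F xs ys) ⟩
  sumOver ys (F x) + (∑[ y ← ys ] ∑[ x′ ← xs ] F x′ y)   ≡⟨ sumOver-+ (F x) (λ y → ∑[ x′ ← xs ] F x′ y) ys ⟨
  (∑[ y ← ys ] (F x y + ∑[ x′ ← xs ] F x′ y))            ∎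
  where open ≡-Reasoning

sumOver-range-single : ∀ N {c} → InRange N c → (F : ℕ → ℕ) → (∀ i → i ≢ c → F i ≡ 0) →
  sumOver (range N) F ≡ F c
sumOver-range-single zero    (() , z≤n)
sumOver-range-single (suc N) {c} (1≤c , c≤1+N) F F≗0 = begin
  sumOver (range (suc N)) F                  ≡⟨ foldr-map-range-punchIn +-0-isCommutativeMonoid N 1≤c c≤1+N F ⟩
  F c + sumOver (range N) (F ∘ punchIn c)    ≡⟨ cong (F c +_) (sumOver-zero (λ i → F≗0 _ (punchIn-≢ c i)) (range N)) ⟩
  F c + 0                                    ≡⟨ +-identityʳ (F c) ⟩
  F c                                        ∎
  where open ≡-Reasoning

sumOver-range-suc : ∀ N (F : ℕ → ℕ) → sumOver (range (suc N)) F ≡ F 1 + sumOver (range N) (F ∘ suc)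
sumOver-range-suc N F =
  trans (cong (λ L → sumOver L F) (range-suc N)) (cong (F 1 +_) (sumOver-map F suc (range N)))

sumOver-range-cong : ∀ N {F G : ℕ → ℕ} → (∀ i → InRange N i → F i ≡ G i) →
  sumOver (range N) F ≡ sumOver (range N) G
sumOver-range-cong zero    F≗G = refl
sumOver-range-cong (suc N) {F} {G} F≗G = begin
  sumOver (range (suc N)) F             ≡⟨ sumOver-range-suc N F ⟩
  F 1 + sumOver (range N) (F ∘ suc)     ≡⟨ cong₂ _+_ (F≗G 1 (≤-refl , s≤s z≤n)) (sumOver-range-cong N F≗G′) ⟩
  G 1 + sumOver (range N) (G ∘ suc)     ≡⟨ sumOver-range-suc N G ⟨
  sumOver (range (suc N)) G             ∎
  where
  open ≡-Reasoning
  F≗G′ : ∀ i → InRange N i → F (suc i) ≡ G (suc i)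
  F≗G′ i (_ , i≤N) = F≗G (suc i) (s≤s z≤n , s≤s i≤N)

sumOver-pairs : ∀ k (G : ℕ × ℕ → ℕ) →
  sumOver (pairs k) G ≡ ∑[ t ← range k ] ∑[ u ← range k ] G (t , u)
sumOver-pairs k G =
  trans (sumOver-concatMap G (λ t → map (t ,_) (range k)) (range k))
        (sumOver-cong (λ t → sumOver-map G (t ,_) (range k)) (range k))

sumOver-pairs-cong : ∀ k {G H : ℕ × ℕ → ℕ} →
  (∀ t u → InRange k t → InRange k u → G (t , u) ≡ H (t , u)) → sumOver (pairs k) G ≡ sumOver (pairs k) H
sumOver-pairs-cong k {G} {H} G≗H = begin
  sumOver (pairs k) G
    ≡⟨ sumOver-pairs k G ⟩
  (∑[ t ← range k ] ∑[ u ← range k ] G (t , u))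
    ≡⟨ sumOver-range-cong k (λ t t∈ → sumOver-range-cong k (λ u u∈ → G≗H t u t∈ u∈)) ⟩
  (∑[ t ← range k ] ∑[ u ← range k ] H (t , u))
    ≡⟨ sumOver-pairs k H ⟨
  sumOver (pairs k) H
    ∎
  where open ≡-Reasoning

sumOver-pairs-single : ∀ k {X Y} → InRange k X → InRange k Y → (G : ℕ × ℕ → ℕ) →
  (∀ t u → t ≢ X ⊎ u ≢ Y → G (t , u) ≡ 0) → sumOver (pairs k) G ≡ G (X , Y)
sumOver-pairs-single k {X} {Y} X∈ Y∈ G G≗0 = begin
  sumOver (pairs k) G
    ≡⟨ sumOver-pairs k G ⟩
  (∑[ t ← range k ] ∑[ u ← range k ] G (t , u))
    ≡⟨ sumOver-range-single k X∈ _ (λ t t≢X → sumOver-zero (λ u → G≗0 t u (inj₁ t≢X)) (range k)) ⟩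
  (∑[ u ← range k ] G (X , u))
    ≡⟨ sumOver-range-single k Y∈ _ (λ u u≢Y → G≗0 X u (inj₂ u≢Y)) ⟩
  G (X , Y)
    ∎
  where open ≡-Reasoning

sumOver-arrays-suc : ∀ m k (G : Array (suc m) → ℕ) →
  sumOver (arrays (suc m) k) G ≡ ∑[ c ← pairs k ] ∑[ v ← arrays m k ] G (c ∷ v)
sumOver-arrays-suc m k G =
  trans (sumOver-concatMap G (λ c → map (c ∷_) (arrays m k)) (pairs k))
        (sumOver-cong (λ c → sumOver-map G (c ∷_) (arrays m k)) (pairs k))

sumOver-arrays-∷ʳ : ∀ m k (G : Array (suc m) → ℕ) →
  sumOver (arrays (suc m) k) G ≡ ∑[ v ← arrays m k ] ∑[ c ← pairs k ] G (v ∷ʳ c)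
sumOver-arrays-∷ʳ zero k G =
  trans (sumOver-arrays-suc zero k G)
        (trans (sumOver-cong (λ c → +-identityʳ (G (c ∷ []))) (pairs k)) (sym (+-identityʳ _)))
sumOver-arrays-∷ʳ (suc m) k G = begin
  sumOver (arrays (suc (suc m)) k) G
    ≡⟨ sumOver-arrays-suc (suc m) k G ⟩
  (∑[ c ← pairs k ] ∑[ v ← arrays (suc m) k ] G (c ∷ v))
    ≡⟨ sumOver-cong (λ c → sumOver-arrays-∷ʳ m k (G ∘ (c ∷_))) (pairs k) ⟩
  (∑[ c ← pairs k ] ∑[ v ← arrays m k ] ∑[ d ← pairs k ] G (c ∷ (v ∷ʳ d)))
    ≡⟨ sumOver-arrays-suc m k (λ w → ∑[ d ← pairs k ] G (w ∷ʳ d)) ⟨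
  (∑[ w ← arrays (suc m) k ] ∑[ d ← pairs k ] G (w ∷ʳ d))
    ∎
  where open ≡-Reasoning

sumOver-arrays-cong : ∀ m k {G H : Array m → ℕ} →
  (∀ v → All (InRange k) (arrayLabels v) → G v ≡ H v) → sumOver (arrays m k) G ≡ sumOver (arrays m k) H
sumOver-arrays-cong zero    k G≗H = cong (_+ 0) (G≗H [] [])
sumOver-arrays-cong (suc m) k {G} {H} G≗H = begin
  sumOver (arrays (suc m) k) G
    ≡⟨ sumOver-arrays-suc m k G ⟩
  (∑[ c ← pairs k ] ∑[ v ← arrays m k ] G (c ∷ v))
    ≡⟨ sumOver-pairs-cong k (λ t u t∈ u∈ → sumOver-arrays-cong m k (λ v v∈ → G≗H _ (t∈ ∷ u∈ ∷ v∈))) ⟩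
  (∑[ c ← pairs k ] ∑[ v ← arrays m k ] H (c ∷ v))
    ≡⟨ sumOver-arrays-suc m k H ⟨
  sumOver (arrays (suc m) k) H
    ∎
  where open ≡-Reasoning

mapLabels : (ℕ → ℕ) → {m : ℕ} → Array m → Array m
mapLabels h = Vec.map (Product.map h h)

module _ {K k : ℕ} (Bad : ℕ → Set) (ι : ℕ → ℕ)
         (reindex-range : ∀ F → (∀ x → Bad x → F x ≡ 0) → sumOver (range K) F ≡ sumOver (range k) (F ∘ ι))
         where

  reindex-pairs : ∀ G → (∀ t u → Bad t ⊎ Bad u → G (t , u) ≡ 0) →
    sumOver (pairs K) G ≡ ∑[ c ← pairs k ] G (Product.map ι ι c)
  reindex-pairs G G≗0 = begin
    sumOver (pairs K) G
      ≡⟨ sumOver-pairs K G ⟩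
    (∑[ t ← range K ] ∑[ u ← range K ] G (t , u))
      ≡⟨ sumOver-cong (λ t → reindex-range _ (λ u → G≗0 t u ∘ inj₂)) (range K) ⟩
    (∑[ t ← range K ] ∑[ u ← range k ] G (t , ι u))
      ≡⟨ reindex-range _ (λ t bad → sumOver-zero (λ u → G≗0 t _ (inj₁ bad)) (range k)) ⟩
    (∑[ t ← range k ] ∑[ u ← range k ] G (ι t , ι u))
      ≡⟨ sumOver-pairs k (G ∘ Product.map ι ι) ⟨
    (∑[ c ← pairs k ] G (Product.map ι ι c))
      ∎
    where open ≡-Reasoning

  reindex-arrays : ∀ m G → (∀ v → Any Bad (arrayLabels v) → G v ≡ 0) →
    sumOver (arrays m K) G ≡ ∑[ w ← arrays m k ] G (mapLabels ι w)
  reindex-arrays zero    G G≗0 = refl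
  reindex-arrays (suc m) G G≗0 = begin
    sumOver (arrays (suc m) K) G
      ≡⟨ sumOver-arrays-suc m K G ⟩
    (∑[ c ← pairs K ] ∑[ v ← arrays m K ] G (c ∷ v))
      ≡⟨ sumOver-cong (λ c → reindex-arrays m (G ∘ (c ∷_)) (λ v → G≗0 _ ∘ there ∘ there)) (pairs K) ⟩
    (∑[ c ← pairs K ] ∑[ w ← arrays m k ] G (c ∷ mapLabels ι w))
      ≡⟨ reindex-pairs _ (λ t u bad → sumOver-zero (λ w → G≗0 _ (badColumn bad)) (arrays m k)) ⟩
    (∑[ c ← pairs k ] ∑[ w ← arrays m k ] G (mapLabels ι (c ∷ w)))
      ≡⟨ sumOver-arrays-suc m k (G ∘ mapLabels ι) ⟨
    sumOver (arrays (suc m) k) (G ∘ mapLabels ι)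
      ∎
    where
    open ≡-Reasoning
    badColumn : ∀ {t u} {ls : List ℕ} → Bad t ⊎ Bad u → Any Bad (t ∷ u ∷ ls)
    badColumn (inj₁ bad) = here bad
    badColumn (inj₂ bad) = there (here bad)

indicator : Bool → ℕ
indicator b = if b then 1 else 0

countB-sumOver : {A : Set} (p : A → Bool) → ∀ xs → countB p xs ≡ ∑[ x ← xs ] indicator (p x)
countB-sumOver p []       = refl
countB-sumOver p (x ∷ xs) with p x
... | true  = cong suc (countB-sumOver p xs)
... | false = countB-sumOver p xs

countB-false : {A : Set} → ∀ xs → countB {A} (λ _ → false) xs ≡ 0
countB-false []       = refl
countB-false (x ∷ xs) = countB-false xs

countB-map : {A B : Set} (p : B → Bool) (h : A → B) → ∀ xs → countB p (map h xs) ≡ countB (p ∘ h) xs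
countB-map p h []       = refl
countB-map p h (x ∷ xs) with p (h x)
... | true  = cong suc (countB-map p h xs)
... | false = countB-map p h xs

countB-cong : {A : Set} {p q : A → Bool} → (∀ x → p x ≡ q x) → ∀ xs → countB p xs ≡ countB q xs
countB-cong {p = p} {q} p≗q xs =
  trans (countB-sumOver p xs) (trans (sumOver-cong (cong indicator ∘ p≗q) xs) (sym (countB-sumOver q xs)))

if-countB : {A : Set} → ∀ b (p : A → Bool) xs → (if b then countB p xs else 0) ≡ countB (λ x → b ∧ p x) xs
if-countB true  p xs = refl
if-countB false p xs = sym (countB-false xs)

allB-foldr : {A : Set} (p : A → Bool) → ∀ xs → allB p xs ≡ foldr _∧_ true (map p xs)
allB-foldr p []       = refl
allB-foldr p (x ∷ xs) = cong (p x ∧_) (allB-foldr p xs)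

allB-cong : {A : Set} {p q : A → Bool} → (∀ x → p x ≡ q x) → ∀ xs → allB p xs ≡ allB q xs
allB-cong {p = p} {q} p≗q xs =
  trans (allB-foldr p xs) (trans (cong (foldr _∧_ true) (map-cong p≗q xs)) (sym (allB-foldr q xs)))

multiplicity : List ℕ → ℕ → ℕ
multiplicity ls c = countB (_≡ᵇ c) ls

absent : List ℕ → ℕ → Bool
absent ls c = multiplicity ls c ≡ᵇ 0

multiplicity-↭ : ∀ {xs ys} → xs ↭ ys → ∀ c → multiplicity xs c ≡ multiplicity ys c
multiplicity-↭ {xs} {ys} xs↭ys c = begin
  multiplicity xs c                  ≡⟨ countB-sumOver (_≡ᵇ c) xs ⟩
  (∑[ x ← xs ] indicator (x ≡ᵇ c))   ≡⟨ foldr-map-↭ +-0-isCommutativeMonoid _ xs↭ys ⟩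
  (∑[ x ← ys ] indicator (x ≡ᵇ c))   ≡⟨ countB-sumOver (_≡ᵇ c) ys ⟨
  multiplicity ys c                  ∎
  where open ≡-Reasoning

multiplicity-∷-≡ : ∀ c ls → multiplicity (c ∷ ls) c ≡ suc (multiplicity ls c)
multiplicity-∷-≡ c ls rewrite ≡ᵇ-true {c} refl = refl

multiplicity-∷-≢ : ∀ {x c} ls → x ≢ c → multiplicity (x ∷ ls) c ≡ multiplicity ls c
multiplicity-∷-≢ ls x≢c rewrite ≡ᵇ-false x≢c = refl

multiplicity-map-strictMono : ∀ {h} → h Preserves _<_ ⟶ _<_ → ∀ ls j →
  multiplicity (map h ls) (h j) ≡ multiplicity ls j
multiplicity-map-strictMono {h} h-mono ls j =
  trans (countB-map (_≡ᵇ h j) h ls) (countB-cong (λ x → strictMono-≡ᵇ h-mono x j) ls)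

absent-map : ∀ (h : ℕ → ℕ) ls {c} → (∀ x → h x ≢ c) → absent (map h ls) c ≡ true
absent-map h ls {c} h≢c = cong (_≡ᵇ 0) (begin
  multiplicity (map h ls) c               ≡⟨ countB-map (_≡ᵇ c) h ls ⟩
  countB (λ x → h x ≡ᵇ c) ls              ≡⟨ countB-cong {q = λ _ → false} (λ x → ≡ᵇ-false (h≢c x)) ls ⟩
  countB (λ _ → false) ls                 ≡⟨ countB-false ls ⟩
  0                                       ∎)
  where open ≡-Reasoning

absent-Any : ∀ {c ls} → Any (_≡ c) ls → absent ls c ≡ false
absent-Any {c} {x ∷ ls} (here refl) rewrite multiplicity-∷-≡ c ls = refl
absent-Any {c} {x ∷ ls} (there c∈ls) with x ≡ᵇ c
... | true  = refl
... | false = absent-Any c∈ls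

isStandardLabels-↭ : ∀ N {xs ys} → xs ↭ ys → isStandardLabels N xs ≡ isStandardLabels N ys
isStandardLabels-↭ N xs↭ys =
  cong₂ _∧_ (cong (_≡ᵇ N) (↭-length xs↭ys)) (allB-cong (λ c → cong (_≡ᵇ 1) (multiplicity-↭ xs↭ys c)) (range N))

labels-∷ʳ : ∀ {m} (v : Array m) t u → arrayLabels (v ∷ʳ (t , u)) ≡ arrayLabels v ++ t ∷ u ∷ []
labels-∷ʳ []            t u = refl
labels-∷ʳ ((x , y) ∷ v) t u = cong (λ ls → x ∷ y ∷ ls) (labels-∷ʳ v t u)

labels-mapLabels : ∀ h {m} (v : Array m) → arrayLabels (mapLabels h v) ≡ map h (arrayLabels v)
labels-mapLabels h []            = refl
labels-mapLabels h ((x , y) ∷ v) = cong (λ ls → h x ∷ h y ∷ ls) (labels-mapLabels h v)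

last-mapLabels : ∀ h {m} (w : Array (suc m)) → Vec.last (mapLabels h w) ≡ Product.map h h (Vec.last w)
last-mapLabels h (c ∷ [])    = refl
last-mapLabels h (c ∷ d ∷ w) = last-mapLabels h (d ∷ w)

last-InRange : ∀ k {m} (w : Array (suc m)) → All (InRange k) (arrayLabels w) →
  InRange k (proj₁ (Vec.last w)) × InRange k (proj₂ (Vec.last w))
last-InRange k (c ∷ [])    (t∈ ∷ u∈ ∷ _) = t∈ , u∈
last-InRange k (c ∷ d ∷ w) (_ ∷ _ ∷ w∈)  = last-InRange k (d ∷ w) w∈

lastColumnIs-last : ∀ X Y {m} (w : Array (suc m)) →
  lastColumnIs X Y w ≡ (proj₁ (Vec.last w) ≡ᵇ X) ∧ (proj₂ (Vec.last w) ≡ᵇ Y)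
lastColumnIs-last X Y (c ∷ [])    = refl
lastColumnIs-last X Y (c ∷ d ∷ w) = lastColumnIs-last X Y (d ∷ w)

lastColumnIs-∷ʳ : ∀ X Y {m} (v : Array m) t u → lastColumnIs X Y (v ∷ʳ (t , u)) ≡ (t ≡ᵇ X) ∧ (u ≡ᵇ Y)
lastColumnIs-∷ʳ X Y []          t u = refl
lastColumnIs-∷ʳ X Y (c ∷ [])    t u = refl
lastColumnIs-∷ʳ X Y (c ∷ d ∷ v) t u = lastColumnIs-∷ʳ X Y (d ∷ v) t u

hasSupport-∷ʳ : ∀ P {m} (w : Array (suc m)) t u →
  hasSupport P (w ∷ʳ (t , u)) ≡ hasSupport P w ∧ P (Ω (piece (proj₁ (Vec.last w)) t (proj₂ (Vec.last w)) u))
hasSupport-∷ʳ P (c ∷ [])          t u = ∧-identityʳ _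
hasSupport-∷ʳ P ((x , y) ∷ d ∷ w) t u =
  trans (cong (P first ∧_) (hasSupport-∷ʳ P (d ∷ w) t u)) (sym (∧-assoc (P first) (hasSupport P (d ∷ w)) _))
  where first = Ω (piece x (proj₁ d) y (proj₂ d))

rank-strictMono : ∀ {h} → h Preserves _<_ ⟶ _<_ → ∀ x p q r → rank (h x) (h p) (h q) (h r) ≡ rank x p q r
rank-strictMono h-mono x p q r
  rewrite strictMono-<ᵇ h-mono p x | strictMono-<ᵇ h-mono q x | strictMono-<ᵇ h-mono r x = refl

Ω-strictMono : ∀ {h} → h Preserves _<_ ⟶ _<_ → ∀ p q r s →
  Ω (piece (h p) (h q) (h r) (h s)) ≡ Ω (piece p q r s)
Ω-strictMono h-mono p q r s
  rewrite rank-strictMono h-mono p q r s | rank-strictMono h-mono q p r s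
        | rank-strictMono h-mono r p q s | rank-strictMono h-mono s p q r = refl

hasSupport-mapLabels : ∀ P {h} → h Preserves _<_ ⟶ _<_ → ∀ {m} (v : Array m) →
  hasSupport P (mapLabels h v) ≡ hasSupport P v
hasSupport-mapLabels P h-mono []                      = refl
hasSupport-mapLabels P h-mono (c ∷ [])                = refl
hasSupport-mapLabels P h-mono ((x , y) ∷ (z , t) ∷ v) =
  cong₂ _∧_ (cong P (Ω-strictMono h-mono x z y t)) (hasSupport-mapLabels P h-mono ((z , t) ∷ v))

-- Removing the last column

module Recursion (P : Piece → Bool) {k a b : ℕ} (1≤a : 1 ≤ a) (a<b : a < b) (b≤2+k : b ≤ suc (suc k))
                 {X Y : ℕ} (X∈ : InRange (suc (suc k)) X) (Y∈ : InRange (suc (suc k)) Y)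
                 (XY↭ab : X ∷ Y ∷ [] ↭ a ∷ b ∷ []) where

  ι : ℕ → ℕ
  ι = punchIn₂ a b

  Bad : ℕ → Set
  Bad l = l ≡ a ⊎ l ≡ b

  sumOver-range-ι : ∀ F → (∀ x → Bad x → F x ≡ 0) → sumOver (range (suc (suc k))) F ≡ sumOver (range k) (F ∘ ι)
  sumOver-range-ι F F≗0 =
    trans (foldr-map-range-punchIn₂ +-0-isCommutativeMonoid k 1≤a a<b b≤2+k F)
          (cong₂ (λ x y → x + (y + sumOver (range k) (F ∘ ι))) (F≗0 a (inj₁ refl)) (F≗0 b (inj₂ refl)))

  isStandardLabels-ab : ∀ ls → isStandardLabels (suc (suc k)) (a ∷ b ∷ ls) ≡
    (length ls ≡ᵇ k) ∧ (absent ls a ∧ (absent ls b ∧ allB (λ j → multiplicity ls (ι j) ≡ᵇ 1) (range k)))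
  isStandardLabels-ab ls = cong ((length ls ≡ᵇ k) ∧_) (begin
    allB Q (range (suc (suc k)))
      ≡⟨ allB-foldr Q (range (suc (suc k))) ⟩
    foldr _∧_ true (map Q (range (suc (suc k))))
      ≡⟨ foldr-map-range-punchIn₂ ∧-isCommutativeMonoid k 1≤a a<b b≤2+k Q ⟩
    Q a ∧ (Q b ∧ foldr _∧_ true (map (Q ∘ ι) (range k)))
      ≡⟨ cong₂ (λ x y → x ∧ (y ∧ foldr _∧_ true (map (Q ∘ ι) (range k)))) Qa Qb ⟩
    absent ls a ∧ (absent ls b ∧ foldr _∧_ true (map (Q ∘ ι) (range k)))
      ≡⟨ cong (λ x → absent ls a ∧ (absent ls b ∧ x))
              (trans (sym (allB-foldr (Q ∘ ι) (range k))) (allB-cong Qι (range k))) ⟩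
    absent ls a ∧ (absent ls b ∧ allB (λ j → multiplicity ls (ι j) ≡ᵇ 1) (range k))
      ∎)
    where
    open ≡-Reasoning
    Q : ℕ → Bool
    Q c = multiplicity (a ∷ b ∷ ls) c ≡ᵇ 1
    Qa : Q a ≡ absent ls a
    Qa = cong (_≡ᵇ 1) (trans (multiplicity-∷-≡ a (b ∷ ls)) (cong suc (multiplicity-∷-≢ ls (≢-sym (<⇒≢ a<b)))))
    Qb : Q b ≡ absent ls b
    Qb = cong (_≡ᵇ 1) (trans (multiplicity-∷-≢ (b ∷ ls) (<⇒≢ a<b)) (multiplicity-∷-≡ b ls))
    Qι : ∀ j → Q (ι j) ≡ (multiplicity ls (ι j) ≡ᵇ 1)
    Qι j = cong (_≡ᵇ 1) (trans (multiplicity-∷-≢ (b ∷ ls) (≢-sym (punchIn₂-≢ˡ a b j)))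
                                (multiplicity-∷-≢ ls (≢-sym (punchIn₂-≢ʳ a<b j))))

  isStandardLabels-ab-map : ∀ ls → isStandardLabels (suc (suc k)) (a ∷ b ∷ map ι ls) ≡ isStandardLabels k ls
  isStandardLabels-ab-map ls = begin
    isStandardLabels (suc (suc k)) (a ∷ b ∷ map ι ls)
      ≡⟨ isStandardLabels-ab (map ι ls) ⟩
    (length (map ι ls) ≡ᵇ k) ∧ (absent (map ι ls) a ∧ (absent (map ι ls) b ∧ onceEach))
      ≡⟨ cong₂ (λ n x → (n ≡ᵇ k) ∧ (x ∧ (absent (map ι ls) b ∧ onceEach)))
               (length-map ι ls) (absent-map ι ls (punchIn₂-≢ˡ a b)) ⟩
    (length ls ≡ᵇ k) ∧ (absent (map ι ls) b ∧ onceEach)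
      ≡⟨ cong (λ x → (length ls ≡ᵇ k) ∧ (x ∧ onceEach)) (absent-map ι ls (punchIn₂-≢ʳ a<b)) ⟩
    (length ls ≡ᵇ k) ∧ onceEach
      ≡⟨ cong ((length ls ≡ᵇ k) ∧_)
              (allB-cong (λ j → cong (_≡ᵇ 1) (multiplicity-map-strictMono (punchIn₂-mono a b) ls j)) (range k)) ⟩
    isStandardLabels k ls
      ∎
    where
    open ≡-Reasoning
    onceEach = allB (λ j → multiplicity (map ι ls) (ι j) ≡ᵇ 1) (range k)

  isStandardLabels-ab-bad : ∀ ls → Any Bad ls → isStandardLabels (suc (suc k)) (a ∷ b ∷ ls) ≡ false
  isStandardLabels-ab-bad ls bad rewrite isStandardLabels-ab ls with Any-⊎⁻ bad
  ... | inj₁ a∈ls rewrite absent-Any a∈ls = ∧-zeroʳ (length ls ≡ᵇ k)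
  ... | inj₂ b∈ls rewrite absent-Any b∈ls = ∧-zeroʳ² (length ls ≡ᵇ k) (absent ls a)

  labels-∷ʳ-↭ : ∀ {m} (v : Array m) → arrayLabels (v ∷ʳ (X , Y)) ↭ a ∷ b ∷ arrayLabels v
  labels-∷ʳ-↭ v = begin
    arrayLabels (v ∷ʳ (X , Y))    ≡⟨ labels-∷ʳ v X Y ⟩
    arrayLabels v ++ X ∷ Y ∷ []   ↭⟨ ++-comm (arrayLabels v) (X ∷ Y ∷ []) ⟩
    X ∷ Y ∷ arrayLabels v         ↭⟨ ++⁺ʳ (arrayLabels v) XY↭ab ⟩
    a ∷ b ∷ arrayLabels v         ∎
    where open PermutationReasoning

  fitsBeforeXY : ℕ × ℕ → Bool
  fitsBeforeXY (x , y) = P (Ω (piece (ι x) X (ι y) Y))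

  Extends : ∀ {m} → Array (suc m) → Bool
  Extends u = isStandardLabels k (arrayLabels u) ∧ (hasSupport P u ∧ fitsBeforeXY (Vec.last u))

  countB-lastColumnIs-XY : ∀ m →
    countB (λ w → isStandardLabels (suc (suc k)) (arrayLabels w) ∧ hasSupport P w ∧ lastColumnIs X Y w)
           (arrays (suc (suc m)) (suc (suc k)))
    ≡ ∑[ u ← arrays (suc m) k ] indicator (Extends u)
  countB-lastColumnIs-XY m = begin
    countB T (arrays (suc (suc m)) K)
      ≡⟨ countB-sumOver T (arrays (suc (suc m)) K) ⟩
    (∑[ w ← arrays (suc (suc m)) K ] indicator (T w))
      ≡⟨ sumOver-arrays-∷ʳ (suc m) K (indicator ∘ T) ⟩
    (∑[ v ← arrays (suc m) K ] ∑[ c ← pairs K ] indicator (T (v ∷ʳ c)))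
      ≡⟨ sumOver-cong select (arrays (suc m) K) ⟩
    (∑[ v ← arrays (suc m) K ] indicator (S v))
      ≡⟨ reindex-arrays {K} {k} Bad ι sumOver-range-ι (suc m) (indicator ∘ S) S-bad ⟩
    (∑[ u ← arrays (suc m) k ] indicator (S (mapLabels ι u)))
      ≡⟨ sumOver-cong (cong indicator ∘ S-mapLabels) (arrays (suc m) k) ⟩
    (∑[ u ← arrays (suc m) k ] indicator (Extends u))
      ∎
    where
    open ≡-Reasoning
    K = suc (suc k)
    T : Array (suc (suc m)) → Bool
    T w = isStandardLabels K (arrayLabels w) ∧ hasSupport P w ∧ lastColumnIs X Y w
    S : Array (suc m) → Bool
    S v = isStandardLabels K (a ∷ b ∷ arrayLabels v) ∧ hasSupport P (v ∷ʳ (X , Y))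
    select : ∀ v → ∑[ c ← pairs K ] indicator (T (v ∷ʳ c)) ≡ indicator (S v)
    select v = trans (sumOver-pairs-single K X∈ Y∈ _ vanish) (cong indicator atXY)
      where
      std supp : ℕ × ℕ → Bool
      std c = isStandardLabels K (arrayLabels (v ∷ʳ c))
      supp c = hasSupport P (v ∷ʳ c)
      vanish : ∀ t u → t ≢ X ⊎ u ≢ Y → indicator (T (v ∷ʳ (t , u))) ≡ 0
      vanish t u ne = cong indicator (trans (cong (λ z → std (t , u) ∧ (supp (t , u) ∧ z))
                                                  (trans (lastColumnIs-∷ʳ X Y v t u) (≡ᵇ-∧-false ne)))
                                            (∧-zeroʳ² (std (t , u)) (supp (t , u))))
      atXY : T (v ∷ʳ (X , Y)) ≡ S v
      atXY = cong₂ _∧_ (isStandardLabels-↭ K (labels-∷ʳ-↭ v))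
                       (trans (cong (supp (X , Y) ∧_) (trans (lastColumnIs-∷ʳ X Y v X Y) (≡ᵇ-∧-refl X Y)))
                              (∧-identityʳ (supp (X , Y))))
    S-bad : ∀ v → Any Bad (arrayLabels v) → indicator (S v) ≡ 0
    S-bad v bad = cong (λ z → indicator (z ∧ hasSupport P (v ∷ʳ (X , Y)))) (isStandardLabels-ab-bad (arrayLabels v) bad)
    S-mapLabels : ∀ u → S (mapLabels ι u) ≡ Extends u
    S-mapLabels u = cong₂ _∧_
      (trans (cong (λ ls → isStandardLabels K (a ∷ b ∷ ls)) (labels-mapLabels ι u))
             (isStandardLabels-ab-map (arrayLabels u)))
      (trans (hasSupport-∷ʳ P (mapLabels ι u) X Y)
             (cong₂ _∧_ (hasSupport-mapLabels P (punchIn₂-mono a b) u)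
                        (cong (λ c → P (Ω (piece (proj₁ c) X (proj₂ c) Y))) (last-mapLabels ι u))))

  sumOver-countB-lastColumnIs : ∀ m →
    (∑[ c ← pairs k ] (if fitsBeforeXY c
                       then countB (λ u → isStandardLabels k (arrayLabels u) ∧ hasSupport P u
                                          ∧ lastColumnIs (proj₁ c) (proj₂ c) u)
                                   (arrays (suc m) k)
                       else 0))
    ≡ ∑[ u ← arrays (suc m) k ] indicator (Extends u)
  sumOver-countB-lastColumnIs m = begin
    (∑[ c ← pairs k ] (if fitsBeforeXY c then countB (R c) A else 0))
      ≡⟨ sumOver-cong (λ c → trans (if-countB (fitsBeforeXY c) (R c) A) (countB-sumOver _ A)) (pairs k) ⟩
    (∑[ c ← pairs k ] ∑[ u ← A ] indicator (fitsBeforeXY c ∧ R c u))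
      ≡⟨ sumOver-swap (λ c u → indicator (fitsBeforeXY c ∧ R c u)) (pairs k) A ⟩
    (∑[ u ← A ] ∑[ c ← pairs k ] indicator (fitsBeforeXY c ∧ R c u))
      ≡⟨ sumOver-arrays-cong (suc m) k select ⟩
    (∑[ u ← A ] indicator (Extends u))
      ∎
    where
    open ≡-Reasoning
    A = arrays (suc m) k
    R : ℕ × ℕ → Array (suc m) → Bool
    R c u = isStandardLabels k (arrayLabels u) ∧ hasSupport P u ∧ lastColumnIs (proj₁ c) (proj₂ c) u
    select : ∀ u → All (InRange k) (arrayLabels u) →
      ∑[ c ← pairs k ] indicator (fitsBeforeXY c ∧ R c u) ≡ indicator (Extends u)
    select u u∈ = trans (sumOver-pairs-single k (proj₁ l∈) (proj₂ l∈) _ vanish) (cong indicator atLast)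
      where
      l₁ = proj₁ (Vec.last u)
      l₂ = proj₂ (Vec.last u)
      l∈ = last-InRange k u u∈
      std = isStandardLabels k (arrayLabels u)
      supp = hasSupport P u
      vanish : ∀ t s → t ≢ l₁ ⊎ s ≢ l₂ → indicator (fitsBeforeXY (t , s) ∧ R (t , s) u) ≡ 0
      vanish t s ne = cong indicator (trans (cong (λ z → fitsBeforeXY (t , s) ∧ (std ∧ (supp ∧ z)))
                                                  (trans (lastColumnIs-last t s u) (≡ᵇ-∧-false (Sum.map ≢-sym ≢-sym ne))))
                                            (trans (cong (fitsBeforeXY (t , s) ∧_) (∧-zeroʳ² std supp))
                                                   (∧-zeroʳ (fitsBeforeXY (t , s)))))
      atLast : fitsBeforeXY (l₁ , l₂) ∧ R (l₁ , l₂) u ≡ Extends u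
      atLast = trans (cong (λ z → fitsBeforeXY (l₁ , l₂) ∧ (std ∧ (supp ∧ z)))
                           (trans (lastColumnIs-last l₁ l₂ u) (≡ᵇ-∧-refl l₁ l₂)))
                     (∧-rotate (fitsBeforeXY (l₁ , l₂)) std supp)

sumOverPairs-sumOver : ∀ g ps → sumOverPairs g ps ≡ sumOver ps g
sumOverPairs-sumOver g []       = refl
sumOverPairs-sumOver g (p ∷ ps) = cong (g p +_) (sumOverPairs-sumOver g ps)

recursion : ∀ P m K → K ≡ suc (suc (2 * suc m)) → ∀ {X Y} → InRange K X → InRange K Y → X ≢ Y →
  countB (λ w → isStandardLabels K (arrayLabels w) ∧ hasSupport P w ∧ lastColumnIs X Y w) (arrays (suc (suc m)) K)
  ≡ ∑[ c ← pairs (2 * suc m) ] (if P (Ω (piece (Ω⁻¹ (proj₁ c) X Y) X (Ω⁻¹ (proj₂ c) X Y) Y))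
                                 then f P (suc m) (proj₁ c) (proj₂ c) else 0)
recursion P m _ refl {X} {Y} X∈ Y∈ X≢Y = begin
  countB (λ w → isStandardLabels K (arrayLabels w) ∧ hasSupport P w ∧ lastColumnIs X Y w) (arrays (suc (suc m)) K)
    ≡⟨ countB-lastColumnIs-XY m ⟩
  (∑[ u ← arrays (suc m) k ] indicator (Extends u))
    ≡⟨ sumOver-countB-lastColumnIs m ⟨
  (∑[ c ← pairs k ] (if fitsBeforeXY c then f P (suc m) (proj₁ c) (proj₂ c) else 0))
    ≡⟨ sumOver-cong (λ c → cong₂ (λ x y → if P (Ω (piece x X y Y)) then f P (suc m) (proj₁ c) (proj₂ c) else 0)
                                 (Ω⁻¹-punchIn₂ (proj₁ c) X Y a<b) (Ω⁻¹-punchIn₂ (proj₂ c) X Y a<b))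
                    (pairs k) ⟨
  (∑[ c ← pairs k ] (if P (Ω (piece (Ω⁻¹ (proj₁ c) X Y) X (Ω⁻¹ (proj₂ c) X Y) Y))
                     then f P (suc m) (proj₁ c) (proj₂ c) else 0))
    ∎
  where
  open ≡-Reasoning
  k = 2 * suc m
  K = suc (suc k)
  a<b = min'<max' X≢Y
  ab∈ = min'-max'-InRange X∈ Y∈
  open Recursion P (proj₁ (proj₁ ab∈)) a<b (proj₂ (proj₂ ab∈)) X∈ Y∈ (↭-min'-max' X Y)

proposition1 : (P : Piece → Bool) → (∀ p → P p ≡ true → isStandardPiece p ≡ true) →
    (n : ℕ) → 2 ≤ n → (X Y : ℕ) → 1 ≤ X → X ≤ 2 * n → 1 ≤ Y → Y ≤ 2 * n → X ≢ Y →
    f P n X Y ≡ recursionRHS P n X Y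
proposition1 P _ (suc (suc m)) (s≤s (s≤s z≤n)) X Y 1≤X X≤2n 1≤Y Y≤2n X≢Y = begin
  f P (suc (suc m)) X Y
    ≡⟨ recursion P m (2 * suc (suc m)) 2n≡2+k (1≤X , X≤2n) (1≤Y , Y≤2n) X≢Y ⟩
  sumOver (pairs (2 * suc m)) g
    ≡⟨ cong (λ N → sumOver (pairs (N ∸ 2)) g) 2n≡2+k ⟨
  sumOver (pairs (2 * suc (suc m) ∸ 2)) g
    ≡⟨ sumOverPairs-sumOver g (pairs (2 * suc (suc m) ∸ 2)) ⟨
  recursionRHS P (suc (suc m)) X Y
    ∎
  where
  open ≡-Reasoning
  2n≡2+k : 2 * suc (suc m) ≡ suc (suc (2 * suc m))
  2n≡2+k = *-suc 2 (suc m)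
  g : ℕ × ℕ → ℕ
  g c = if P (Ω (piece (Ω⁻¹ (proj₁ c) X Y) X (Ω⁻¹ (proj₂ c) X Y) Y)) then f P (suc m) (proj₁ c) (proj₂ c) else 0
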